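{- Let $\mathscr L$ be a simple affine oriented matroid on $E$ and let $\pi\subseteq E$ be a parallelism class. Define the ternary relation on $\pi$ by: $[f,g,h]$ holds iff $f,g,h$ are pairwise distinct and for all $X,Z\in\mathscr L$ with $X(f)=0$ and $Z(h)=0$ one has $X(g)=-Z(g)$. Then for all $a,b,c,x\in\pi$: (BR1) $[a,b,c]$ implies $a,b,c$ pairwise distinct; (BR2) if $a,b,c$ are pairwise distinct, then $[\sigma(a),\sigma(b),\sigma(c)]$ holds for some permutation $\sigma$ of $\{a,b,c\}$; (BR3) $[a,b,c]$ implies $[c,b,a]$; (BR4) $[a,b,c]$ and $[a,c,b]$ do not both hold; (BR5) if $[a,b,c]$ and $x\notin\{a,b,c\}$, then $[a,b,x]$ or $[x,b,c]$. Moreover this relation is invariant under reorientation: for every $\tau\in\{+1,-1\}^E$, the relation defined in the same way from $\mathscr L^{(\tau)}$ coincides with the one defined from $\mathscr L$.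
   Context: Sign vectors on $E$ are maps $X:E\to\{+,-,0\}$; $z(X)=\{e:X(e)=0\}$, $\underline X=E\setminus z(X)$, $S(X,Y)=\{e\in\underline X\cap\underline Y:X(e)\ne Y(e)\}$, $(X\circ Y)(e)=X(e)$ if $X(e)\ne0$ else $Y(e)$, $(X\oplus Y)(e)=0$ if $e\in S(X,Y)$ else $(X\circ Y)(e)$. For $\mathscr L\subseteq\{+,-,0\}^E$: $I_e(X,Y)=\{Z\in\mathscr L:Z(e)=0,\ Z(f)=(X\circ Y)(f)\ \forall f\notin S(X,Y)\}$, $I(X,Y)=\bigcup_{e\in S(X,Y)}I_e(X,Y)$, $\mathcal P(\mathscr L)=\{X\oplus(-Y):X,Y\in\mathscr L,\ I(X,-Y)=I(-X,Y)=\emptyset\}$. An affine oriented matroid (AOM) is $\mathscr L$ with (FS) $X\circ(-Y)\in\mathscr L$ for $X,Y\in\mathscr L$; (SE) $I_e(X,Y)\ne\emptyset$ for $X,Y\in\mathscr L$, $e\in S(X,Y)$; (P) $P\circ X\in\mathscr L$ for $P\in\mathcal P(\mathscr L)$, $X\in\mathscr L$. $e\parallel f$ iff no $X\in\mathscr L$ has $e,f\in z(X)$. $\mathscr L$ is simple if no $e$ has $X(e)=Y(e)$ for all $X,Y\in\mathscr L$ and no distinct $e,f$ satisfy $X(e)=X(f)$ for all $X$ or $X(e)=-X(f)$ for all $X$. In a simple AOM, the reflexive closure of $\parallel$ is an equivalence relation; its classes are the parallelism classes. The reorientation by $\tau\in\{\pm1\}^E$ is $\mathscr L^{(\tau)}=\{\tau\cdot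 X:X\in\mathscr L\}$, $(\tau\cdot X)(e)=\tau(e)X(e)$. -}

module Defs where

open import Data.Nat using (ℕ)
open import Data.Fin using (Fin)
open import Data.Vec using (Vec; lookup; map; zipWith)
open import Data.List using (List)
import Data.List as List
open import Data.List.Membership.Propositional using (_∈_)
open import Data.Bool using (Bool; true; false)
open import Data.Product using (_×_; Σ; ∃; _,_)
open import Data.Sum using (_⊎_)
open import Relation.Nullary using (¬_)
open import Relation.Binary.PropositionalEquality using (_≡_; _≢_)
open import Function.Bundles using (_⇔_)

data Sign : Set where
  pos neg zer : Sign

-ˢ_ : Sign → Sign
-ˢ pos = neg
-ˢ neg = pos
-ˢ zer = zer

-- The ground set E is Fin n; sign vectors are Vec Sign n.
SignVec : ℕ → Set
SignVec n = Vec Sign n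

SignSet : ℕ → Set
SignSet n = List (SignVec n)

module _ {n : ℕ} where

  _at_ : SignVec n → Fin n → Sign
  X at e = lookup X e

  negV : SignVec n → SignVec n
  negV X = map -ˢ_ X

  compˢ : Sign → Sign → Sign
  compˢ zer y = y
  compˢ pos y = pos
  compˢ neg y = neg

  _∘ᵛ_ : SignVec n → SignVec n → SignVec n
  X ∘ᵛ Y = zipWith compˢ X Y

  InZero : SignVec n → Fin n → Set
  InZero X e = X at e ≡ zer

  InSep : SignVec n → SignVec n → Fin n → Set
  InSep X Y e = (X at e ≢ zer) × (Y at e ≢ zer) × (X at e ≢ Y at e)

  oplusˢ : Sign → Sign → Sign
  oplusˢ pos neg = zer
  oplusˢ neg pos = zer
  oplusˢ x y = compˢ x y

  _⊕ᵛ_ : SignVec n → SignVec n → SignVec n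
  X ⊕ᵛ Y = zipWith oplusˢ X Y

  InIe : SignSet n → Fin n → SignVec n → SignVec n → SignVec n → Set
  InIe L e X Y Z =
    (Z ∈ L) × (Z at e ≡ zer) ×
    (∀ (f : Fin n) → ¬ InSep X Y f → Z at f ≡ (X ∘ᵛ Y) at f)

  IEmpty : SignSet n → SignVec n → SignVec n → Set
  IEmpty L X Y = ¬ Σ (Fin n) (λ e → InSep X Y e × Σ (SignVec n) (λ Z → InIe L e X Y Z))

  InP : SignSet n → SignVec n → Set
  InP L P = Σ (SignVec n) λ X → Σ (SignVec n) λ Y →
    (X ∈ L) × (Y ∈ L) × IEmpty L X (negV Y) × IEmpty L (negV X) Y ×
    (P ≡ X ⊕ᵛ negV Y)

  record IsAOM (L : SignSet n) : Set where
    field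
      FS : ∀ X Y → X ∈ L → Y ∈ L → (X ∘ᵛ negV Y) ∈ L
      SE : ∀ X Y → X ∈ L → Y ∈ L → (e : Fin n) → InSep X Y e →
           Σ (SignVec n) (λ Z → InIe L e X Y Z)
      P  : ∀ P X → InP L P → X ∈ L → (P ∘ᵛ X) ∈ L

  Parallel : SignSet n → Fin n → Fin n → Set
  Parallel L e f = ¬ Σ (SignVec n) (λ X → (X ∈ L) × InZero X e × InZero X f)

  record IsSimple (L : SignSet n) : Set where
    field
      noConst : ∀ (e : Fin n) → ¬ (∀ X Y → X ∈ L → Y ∈ L → X at e ≡ Y at e)
      noEqual : ∀ (e f : Fin n) → e ≢ f → ¬ (∀ X → X ∈ L → X at e ≡ X at f)
      noOpp   : ∀ (e f : Fin n) → e ≢ f → ¬ (∀ X → X ∈ L → X at e ≡ -ˢ (X at f))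

  IsParClass : SignSet n → (Fin n → Set) → Set
  IsParClass L π = Σ (Fin n) λ e → ∀ (f : Fin n) → π f ⇔ ((f ≡ e) ⊎ Parallel L e f)

  Btw : SignSet n → Fin n → Fin n → Fin n → Set
  Btw L f g h = (f ≢ g) × (g ≢ h) × (f ≢ h) ×
    (∀ X Z → X ∈ L → Z ∈ L → X at f ≡ zer → Z at h ≡ zer → X at g ≡ -ˢ (Z at g))

  -- reorientation by τ ∈ {±1}^E (true = +1, false = -1)
  actˢ : Bool → Sign → Sign
  actˢ true s = s
  actˢ false s = -ˢ s

  reorientV : Vec Bool n → SignVec n → SignVec n
  reorientV τ X = zipWith actˢ τ X

  reorient : Vec Bool n → SignSet n → SignSet n
  reorient τ L = List.map (reorientV τ) L

-- For f ∥ g, all vectors of L vanishing at f take the same sign at g (otherwise eliminating g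
-- between two of them gives a common zero of f and g), so [f,g,h] only compares one zero of f
-- with one zero of h at g. This yields BR1, BR3, BR5 and, with one more elimination, BR4, while
-- reorienting multiplies both sides of each defining equation by the same sign.
-- Transitivity of parallelism, needed to treat the whole class π, and BR2 use axiom (P): for
-- zeros X of f and Y of g every P ∈ 𝒫 satisfies X(g)P(g) = -Y(f)P(f), because P ∘ X, -P ∘ X,
-- P ∘ Y, -P ∘ Y ∈ L; and for W, X ∈ L some P ∈ 𝒫 agrees with W on the zeros of X, obtained by
-- eliminating until I(W,-X) = I(-W,X) = ∅. If no betweenness held for a, b, c, the three
-- cross relations for such a P would contradict each other.
module Submission where

open import Defs
open import Data.Nat using (ℕ)
open import Data.Fin using (Fin)
open import Data.Fin.Properties using (any?; all?)
open import Data.Fin.Subset using (Subset; _⊂_) renaming (_∈_ to _∈ₛ_)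
open import Data.Fin.Subset.Induction using (Acc; acc; ⊂-wellFounded)
open import Data.Vec using (Vec; []; _∷_; lookup; tabulate)
open import Data.Vec.Properties using (lookup-map; lookup-zipWith; lookup∘tabulate; []=⇒lookup; lookup⇒[]=)
open import Data.Bool using (Bool; true; false)
open import Data.Product using (_×_; ∃; ∃-syntax; _,_)
open import Data.Sum using (_⊎_; inj₁; inj₂; [_,_]′)
import Data.Sum as Sum
open import Data.Empty using (⊥; ⊥-elim)
open import Data.List using (List)
open import Data.List.Membership.Propositional using (_∈_; find; lose)
open import Data.List.Membership.Propositional.Properties using (∈-map⁺; ∈-map⁻)
import Data.List.Relation.Unary.Any as Any
open import Function using (_∘_; id)
open import Function.Bundles using (_⇔_; mk⇔; Equivalence)
open import Relation.Nullary using (¬_; Dec; yes; no; does)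
open import Relation.Nullary.Decidable using (¬?; _×-dec_; _→-dec_; map′; dec-true)
open import Relation.Unary using (Pred; Decidable)
open import Relation.Binary.Definitions using (DecidableEquality)
open import Relation.Binary.PropositionalEquality
  using (_≡_; _≢_; refl; sym; trans; cong; cong₂; subst; subst₂; ≢-sym; module ≡-Reasoning)

open ≡-Reasoning

infix 4 _≟ˢ_

_≟ˢ_ : DecidableEquality Sign
pos ≟ˢ pos = yes refl
pos ≟ˢ neg = no λ ()
pos ≟ˢ zer = no λ ()
neg ≟ˢ pos = no λ ()
neg ≟ˢ neg = yes refl
neg ≟ˢ zer = no λ ()
zer ≟ˢ pos = no λ ()
zer ≟ˢ neg = no λ ()
zer ≟ˢ zer = yes refl

infixl 7 _*ˢ_

_*ˢ_ : Sign → Sign → Sign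
pos *ˢ y = y
neg *ˢ y = -ˢ y
zer *ˢ _ = zer

-ˢ-involutive : ∀ x → -ˢ -ˢ x ≡ x
-ˢ-involutive pos = refl
-ˢ-involutive neg = refl
-ˢ-involutive zer = refl

-ˢ-injective : ∀ {x y} → -ˢ x ≡ -ˢ y → x ≡ y
-ˢ-injective {x} {y} eq = trans (sym (-ˢ-involutive x)) (trans (cong -ˢ_ eq) (-ˢ-involutive y))

opposite-sym : ∀ {x y} → x ≡ -ˢ y → y ≡ -ˢ x
opposite-sym {x} {y} eq = sym (trans (cong -ˢ_ eq) (-ˢ-involutive y))

self-opposite⇒zer : ∀ {x} → x ≡ -ˢ x → x ≡ zer
self-opposite⇒zer {pos} ()
self-opposite⇒zer {neg} ()
self-opposite⇒zer {zer} _ = refl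

equal-or-opposite : ∀ {x y} → x ≢ zer → y ≢ zer → x ≡ y ⊎ x ≡ -ˢ y
equal-or-opposite {pos} {pos} _ _ = inj₁ refl
equal-or-opposite {pos} {neg} _ _ = inj₂ refl
equal-or-opposite {neg} {pos} _ _ = inj₂ refl
equal-or-opposite {neg} {neg} _ _ = inj₁ refl
equal-or-opposite {zer} x≢0 _ = ⊥-elim (x≢0 refl)
equal-or-opposite {_} {zer} _ y≢0 = ⊥-elim (y≢0 refl)

*ˢ-self : ∀ {x} → x ≢ zer → x *ˢ x ≡ pos
*ˢ-self {pos} _ = refl
*ˢ-self {neg} _ = refl
*ˢ-self {zer} x≢0 = ⊥-elim (x≢0 refl)

*ˢ-cancel : ∀ {s t} → s ≢ zer → t ≢ zer →
            (∀ {u v} → s *ˢ u ≡ t *ˢ v → u ≡ v) ⊎ (∀ {u v} → s *ˢ u ≡ t *ˢ v → u ≡ -ˢ v)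
*ˢ-cancel {pos} {pos} _ _ = inj₁ id
*ˢ-cancel {pos} {neg} _ _ = inj₂ id
*ˢ-cancel {neg} {pos} _ _ = inj₂ (opposite-sym ∘ sym)
*ˢ-cancel {neg} {neg} _ _ = inj₁ -ˢ-injective
*ˢ-cancel {zer} s≢0 _ = ⊥-elim (s≢0 refl)
*ˢ-cancel {_} {zer} _ t≢0 = ⊥-elim (t≢0 refl)

Sep : Sign → Sign → Set
Sep x y = x ≢ zer × y ≢ zer × x ≢ y

Sep? : ∀ x y → Dec (Sep x y)
Sep? x y = ¬? (x ≟ˢ zer) ×-dec ¬? (y ≟ˢ zer) ×-dec ¬? (x ≟ˢ y)

Sep-sym : ∀ {x y} → Sep x y → Sep y x
Sep-sym (x≢0 , y≢0 , x≢y) = y≢0 , x≢0 , ≢-sym x≢y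

Sep-neg⇔ : ∀ {x y} → Sep (-ˢ x) y ⇔ Sep x (-ˢ y)
Sep-neg⇔ {x} {y} = mk⇔
  (λ (-x≢0 , y≢0 , -x≢y) → -x≢0 ∘ cong -ˢ_ , y≢0 ∘ -ˢ-injective ,
                           λ x≡-y → -x≢y (trans (cong -ˢ_ x≡-y) (-ˢ-involutive y)))
  (λ (x≢0 , -y≢0 , x≢-y) → x≢0 ∘ -ˢ-injective , -y≢0 ∘ cong -ˢ_ ,
                           λ -x≡y → x≢-y (opposite-sym (sym -x≡y)))

∃∈? : ∀ {a p} {A : Set a} {P : Pred A p} → Decidable P → (xs : List A) → Dec (∃[ x ] x ∈ xs × P x)
∃∈? P? xs = map′ find (λ (_ , x∈xs , Px) → lose x∈xs Px) (Any.any? P? xs)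

module _ {n p} {P : Pred (Fin n) p} (P? : Decidable P) where

  ∈-tabulate-does⁺ : ∀ {e} → P e → e ∈ₛ tabulate (does ∘ P?)
  ∈-tabulate-does⁺ {e} Pe = lookup⇒[]= e _ (trans (lookup∘tabulate (does ∘ P?) e) (dec-true (P? e) Pe))

  ∈-tabulate-does⁻ : ∀ {e} → e ∈ₛ tabulate (does ∘ P?) → P e
  ∈-tabulate-does⁻ {e} e∈ with P? e | trans (sym (lookup∘tabulate (does ∘ P?) e)) ([]=⇒lookup e∈)
  ... | yes Pe | _ = Pe
  ... | no _ | ()

tabulate-does-⊂ : ∀ {n p q} {P : Pred (Fin n) p} {Q : Pred (Fin n) q}
                  (P? : Decidable P) (Q? : Decidable Q) →
                  (∀ {f} → ¬ Q f → ¬ P f) → ∀ {e} → Q e → ¬ P e →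
                  tabulate (does ∘ P?) ⊂ tabulate (does ∘ Q?)
tabulate-does-⊂ {P = P} {Q} P? Q? ¬Q⇒¬P {e} Qe ¬Pe =
  (λ {f} f∈P → ∈-tabulate-does⁺ Q? (P⇒Q (∈-tabulate-does⁻ P? f∈P))) ,
  e , ∈-tabulate-does⁺ Q? Qe , ¬Pe ∘ ∈-tabulate-does⁻ P?
  where
  P⇒Q : ∀ {f} → P f → Q f
  P⇒Q {f} Pf with Q? f
  ... | yes Qf = Qf
  ... | no ¬Qf = ⊥-elim (¬Q⇒¬P ¬Qf Pf)

∥-sym : ∀ {n} {L : SignSet n} {f g} → Parallel L f g → Parallel L g f
∥-sym f∥g (X , X∈L , Xg , Xf) = f∥g (X , X∈L , Xf , Xg)

∥⇒nonzero : ∀ {n} {L : SignSet n} {f g X} → Parallel L f g → X ∈ L → X at f ≡ zer → X at g ≢ zer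
∥⇒nonzero f∥g X∈L Xf Xg = f∥g (_ , X∈L , Xf , Xg)

Btw-sym : ∀ {n} {L : SignSet n} {a b c} → Btw L a b c → Btw L c b a
Btw-sym (a≢b , b≢c , a≢c , abc) =
  ≢-sym b≢c , ≢-sym a≢b , ≢-sym a≢c , λ X Z X∈L Z∈L Xc Za → opposite-sym (abc Z X Z∈L X∈L Za Xc)

module _ {n : ℕ} where

  -- compˢ, oplusˢ and actˢ take a spurious size argument n, fixed here.
  infixr 5 _∘ˢ_ _⊕ˢ_
  _∘ˢ_ : Sign → Sign → Sign
  _∘ˢ_ = compˢ {n}

  _⊕ˢ_ : Sign → Sign → Sign
  _⊕ˢ_ = oplusˢ {n}

  ∘ˢ-identityʳ : ∀ x → x ∘ˢ zer ≡ x
  ∘ˢ-identityʳ pos = refl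
  ∘ˢ-identityʳ neg = refl
  ∘ˢ-identityʳ zer = refl

  ∘ˢ-absorbʳ : ∀ x w → (x ∘ˢ w) ∘ˢ w ≡ x ∘ˢ w
  ∘ˢ-absorbʳ pos w = refl
  ∘ˢ-absorbʳ neg w = refl
  ∘ˢ-absorbʳ zer pos = refl
  ∘ˢ-absorbʳ zer neg = refl
  ∘ˢ-absorbʳ zer zer = refl

  ∘ˢ-absorbˡ : ∀ x w → x ∘ˢ (x ∘ˢ w) ≡ x ∘ˢ w
  ∘ˢ-absorbˡ pos w = refl
  ∘ˢ-absorbˡ neg w = refl
  ∘ˢ-absorbˡ zer w = refl

  -ˢ-∘ˢ : ∀ x y → -ˢ (x ∘ˢ y) ≡ -ˢ x ∘ˢ -ˢ y
  -ˢ-∘ˢ pos y = refl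
  -ˢ-∘ˢ neg y = refl
  -ˢ-∘ˢ zer y = refl

  ∘ˢ-comm-¬Sep : ∀ x y → ¬ Sep x y → x ∘ˢ y ≡ y ∘ˢ x
  ∘ˢ-comm-¬Sep pos pos _ = refl
  ∘ˢ-comm-¬Sep neg neg _ = refl
  ∘ˢ-comm-¬Sep pos neg ¬sep = ⊥-elim (¬sep ((λ ()) , (λ ()) , (λ ())))
  ∘ˢ-comm-¬Sep neg pos ¬sep = ⊥-elim (¬sep ((λ ()) , (λ ()) , (λ ())))
  ∘ˢ-comm-¬Sep pos zer _ = refl
  ∘ˢ-comm-¬Sep neg zer _ = refl
  ∘ˢ-comm-¬Sep zer y _ = sym (∘ˢ-identityʳ y)

  ⊕ˢ-¬Sep : ∀ x y → ¬ Sep x y → x ⊕ˢ y ≡ x ∘ˢ y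
  ⊕ˢ-¬Sep pos neg ¬sep = ⊥-elim (¬sep ((λ ()) , (λ ()) , (λ ())))
  ⊕ˢ-¬Sep neg pos ¬sep = ⊥-elim (¬sep ((λ ()) , (λ ()) , (λ ())))
  ⊕ˢ-¬Sep pos pos _ = refl
  ⊕ˢ-¬Sep pos zer _ = refl
  ⊕ˢ-¬Sep neg neg _ = refl
  ⊕ˢ-¬Sep neg zer _ = refl
  ⊕ˢ-¬Sep zer y _ = refl

  -ˢ-⊕ˢ : ∀ x y → -ˢ (x ⊕ˢ -ˢ y) ≡ y ⊕ˢ -ˢ x
  -ˢ-⊕ˢ pos pos = refl
  -ˢ-⊕ˢ pos neg = refl
  -ˢ-⊕ˢ pos zer = refl
  -ˢ-⊕ˢ neg pos = refl
  -ˢ-⊕ˢ neg neg = refl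
  -ˢ-⊕ˢ neg zer = refl
  -ˢ-⊕ˢ zer pos = refl
  -ˢ-⊕ˢ zer neg = refl
  -ˢ-⊕ˢ zer zer = refl

  ¬Sep-∘ˢˡ : ∀ x w → ¬ Sep x w → ¬ Sep (x ∘ˢ w) w
  ¬Sep-∘ˢˡ pos w ¬sep = ¬sep
  ¬Sep-∘ˢˡ neg w ¬sep = ¬sep
  ¬Sep-∘ˢˡ zer w _ (_ , _ , w≢w) = w≢w refl

  ¬Sep-∘ˢʳ : ∀ x w → ¬ Sep x (x ∘ˢ w)
  ¬Sep-∘ˢʳ pos w (_ , _ , x≢x) = x≢x refl
  ¬Sep-∘ˢʳ neg w (_ , _ , x≢x) = x≢x refl
  ¬Sep-∘ˢʳ zer w (x≢0 , _ , _) = x≢0 refl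

  -- The pair (p , q) = (P at f , P at g) allowed by ∥-dichotomy for both P ∘ᵛ X and P ∘ᵛ Y,
  -- where x = X at g and y = Y at f.
  Compatible : Sign → Sign → Sign → Sign → Set
  Compatible x y p q = (p ≡ y ⊎ q ∘ˢ x ≡ x) × (p ∘ˢ y ≡ y ⊎ q ≡ x)

  Compatible±⇒cross : ∀ x y p q → x ≢ zer → y ≢ zer →
                      Compatible x y p q → Compatible x y (-ˢ p) (-ˢ q) → x *ˢ q ≡ -ˢ (y *ˢ p)
  Compatible±⇒cross zer _ _ _ x≢0 _ _ _ = ⊥-elim (x≢0 refl)
  Compatible±⇒cross _ zer _ _ _ y≢0 _ _ = ⊥-elim (y≢0 refl)
  Compatible±⇒cross pos pos pos pos _ _ _ (c , _) = ⊥-elim ([ (λ ()) , (λ ()) ]′ c)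
  Compatible±⇒cross pos pos pos neg _ _ _ _ = refl
  Compatible±⇒cross pos pos pos zer _ _ _ (_ , c) = ⊥-elim ([ (λ ()) , (λ ()) ]′ c)
  Compatible±⇒cross pos pos neg pos _ _ _ _ = refl
  Compatible±⇒cross pos pos neg neg _ _ (_ , c) _ = ⊥-elim ([ (λ ()) , (λ ()) ]′ c)
  Compatible±⇒cross pos pos neg zer _ _ (_ , c) _ = ⊥-elim ([ (λ ()) , (λ ()) ]′ c)
  Compatible±⇒cross pos pos zer pos _ _ _ (c , _) = ⊥-elim ([ (λ ()) , (λ ()) ]′ c)
  Compatible±⇒cross pos pos zer neg _ _ (c , _) _ = ⊥-elim ([ (λ ()) , (λ ()) ]′ c)
  Compatible±⇒cross pos pos zer zer _ _ _ _ = refl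
  Compatible±⇒cross pos neg pos pos _ _ _ _ = refl
  Compatible±⇒cross pos neg pos neg _ _ (_ , c) _ = ⊥-elim ([ (λ ()) , (λ ()) ]′ c)
  Compatible±⇒cross pos neg pos zer _ _ (_ , c) _ = ⊥-elim ([ (λ ()) , (λ ()) ]′ c)
  Compatible±⇒cross pos neg neg pos _ _ _ (c , _) = ⊥-elim ([ (λ ()) , (λ ()) ]′ c)
  Compatible±⇒cross pos neg neg neg _ _ _ _ = refl
  Compatible±⇒cross pos neg neg zer _ _ _ (_ , c) = ⊥-elim ([ (λ ()) , (λ ()) ]′ c)
  Compatible±⇒cross pos neg zer pos _ _ _ (c , _) = ⊥-elim ([ (λ ()) , (λ ()) ]′ c)
  Compatible±⇒cross pos neg zer neg _ _ (c , _) _ = ⊥-elim ([ (λ ()) , (λ ()) ]′ c)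
  Compatible±⇒cross pos neg zer zer _ _ _ _ = refl
  Compatible±⇒cross neg pos pos pos _ _ _ _ = refl
  Compatible±⇒cross neg pos pos neg _ _ _ (c , _) = ⊥-elim ([ (λ ()) , (λ ()) ]′ c)
  Compatible±⇒cross neg pos pos zer _ _ _ (_ , c) = ⊥-elim ([ (λ ()) , (λ ()) ]′ c)
  Compatible±⇒cross neg pos neg pos _ _ (_ , c) _ = ⊥-elim ([ (λ ()) , (λ ()) ]′ c)
  Compatible±⇒cross neg pos neg neg _ _ _ _ = refl
  Compatible±⇒cross neg pos neg zer _ _ (_ , c) _ = ⊥-elim ([ (λ ()) , (λ ()) ]′ c)
  Compatible±⇒cross neg pos zer pos _ _ (c , _) _ = ⊥-elim ([ (λ ()) , (λ ()) ]′ c)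
  Compatible±⇒cross neg pos zer neg _ _ _ (c , _) = ⊥-elim ([ (λ ()) , (λ ()) ]′ c)
  Compatible±⇒cross neg pos zer zer _ _ _ _ = refl
  Compatible±⇒cross neg neg pos pos _ _ (_ , c) _ = ⊥-elim ([ (λ ()) , (λ ()) ]′ c)
  Compatible±⇒cross neg neg pos neg _ _ _ _ = refl
  Compatible±⇒cross neg neg pos zer _ _ (_ , c) _ = ⊥-elim ([ (λ ()) , (λ ()) ]′ c)
  Compatible±⇒cross neg neg neg pos _ _ _ _ = refl
  Compatible±⇒cross neg neg neg neg _ _ _ (c , _) = ⊥-elim ([ (λ ()) , (λ ()) ]′ c)
  Compatible±⇒cross neg neg neg zer _ _ _ (_ , c) = ⊥-elim ([ (λ ()) , (λ ()) ]′ c)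
  Compatible±⇒cross neg neg zer pos _ _ (c , _) _ = ⊥-elim ([ (λ ()) , (λ ()) ]′ c)
  Compatible±⇒cross neg neg zer neg _ _ _ (c , _) = ⊥-elim ([ (λ ()) , (λ ()) ]′ c)
  Compatible±⇒cross neg neg zer zer _ _ _ _ = refl

  at-negV : ∀ (X : SignVec n) f → negV X at f ≡ -ˢ (X at f)
  at-negV X f = lookup-map f -ˢ_ X

  at-∘ᵛ : ∀ (X Y : SignVec n) f → (X ∘ᵛ Y) at f ≡ X at f ∘ˢ Y at f
  at-∘ᵛ X Y f = lookup-zipWith _∘ˢ_ f X Y

  at-⊕ᵛ : ∀ (X Y : SignVec n) f → (X ⊕ᵛ Y) at f ≡ X at f ⊕ˢ Y at f
  at-⊕ᵛ X Y f = lookup-zipWith _⊕ˢ_ f X Y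

  ∘ᵛ-zeroʳ-at : ∀ {X Y : SignVec n} {f} → Y at f ≡ zer → (X ∘ᵛ Y) at f ≡ X at f
  ∘ᵛ-zeroʳ-at {X} {Y} {f} Yf = trans (at-∘ᵛ X Y f) (trans (cong (X at f ∘ˢ_) Yf) (∘ˢ-identityʳ _))

  InSep-negV⇔ : ∀ (X Y : SignVec n) f → InSep (negV X) Y f ⇔ InSep X (negV Y) f
  InSep-negV⇔ X Y f =
    subst₂ (λ s t → Sep s (Y at f) ⇔ Sep (X at f) t) (sym (at-negV X f)) (sym (at-negV Y f)) Sep-neg⇔

  negV-⊕ᵛ-negV : ∀ {m} (X Y : Vec Sign m) → negV (X ⊕ᵛ negV Y) ≡ Y ⊕ᵛ negV X
  negV-⊕ᵛ-negV [] [] = refl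
  negV-⊕ᵛ-negV (x ∷ X) (y ∷ Y) = cong₂ _∷_ (-ˢ-⊕ˢ x y) (negV-⊕ᵛ-negV X Y)

  module _ (L : SignSet n) where

    IEmpty-sym : ∀ X Y → IEmpty L X Y → IEmpty L Y X
    IEmpty-sym X Y I-empty (e , e∈S , Z , Z∈L , Ze , Z≈Y∘X) =
      I-empty (e , Sep-sym e∈S , Z , Z∈L , Ze , λ f f∉S →
        begin
          Z at f             ≡⟨ Z≈Y∘X f (f∉S ∘ Sep-sym) ⟩
          (Y ∘ᵛ X) at f      ≡⟨ at-∘ᵛ Y X f ⟩
          Y at f ∘ˢ X at f   ≡⟨ ∘ˢ-comm-¬Sep _ _ (f∉S ∘ Sep-sym) ⟩
          X at f ∘ˢ Y at f   ≡⟨ sym (at-∘ᵛ X Y f) ⟩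
          (X ∘ᵛ Y) at f      ∎)

    𝒫-neg : ∀ {P} → InP L P → InP L (negV P)
    𝒫-neg (X , Y , X∈L , Y∈L , I₁ , I₂ , refl) =
      Y , X , Y∈L , X∈L , IEmpty-sym (negV X) Y I₂ , IEmpty-sym X (negV Y) I₁ , negV-⊕ᵛ-negV X Y

    InSep? : ∀ (X Y : SignVec n) → Decidable (InSep X Y)
    InSep? X Y f = Sep? (X at f) (Y at f)

    I? : ∀ (X Y : SignVec n) → Dec (∃[ e ] InSep X Y e × ∃[ Z ] InIe L e X Y Z)
    I? X Y = any? λ e → InSep? X Y e ×-dec ∃∈? (λ Z → Z at e ≟ˢ zer ×-dec
               all? λ f → ¬? (InSep? X Y f) →-dec Z at f ≟ˢ (X ∘ᵛ Y) at f) L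

    SepSet : SignVec n → SignVec n → Subset n
    SepSet X Y = tabulate (does ∘ InSep? X Y)

    AgreesOff : SignVec n → SignVec n → SignVec n → SignVec n → Set
    AgreesOff Z X W V = ∀ f → ¬ InSep X W f → Z at f ≡ V at f

    Eliminant : Fin n → SignVec n → SignVec n → SignVec n → Set
    Eliminant e X W Z = InSep X W e × Z at e ≡ zer × AgreesOff Z X W (X ∘ᵛ W)

    eliminantˡ-¬InSep : ∀ (X W Z : SignVec n) {e f} → Eliminant e X W Z →
                        ¬ InSep X W f → ¬ InSep Z W f
    eliminantˡ-¬InSep X W Z {f = f} (_ , _ , Z≈) f∉S =
      subst (λ z → ¬ Sep z (W at f)) (sym (trans (Z≈ f f∉S) (at-∘ᵛ X W f))) (¬Sep-∘ˢˡ _ _ f∉S)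

    eliminantʳ-¬InSep : ∀ (X W Z : SignVec n) {e f} → Eliminant e X W Z →
                        ¬ InSep X W f → ¬ InSep X Z f
    eliminantʳ-¬InSep X W Z {f = f} (_ , _ , Z≈) f∉S =
      subst (λ z → ¬ Sep (X at f) z) (sym (trans (Z≈ f f∉S) (at-∘ᵛ X W f))) (¬Sep-∘ˢʳ _ _)

    eliminantˡ-⊂ : ∀ (X W Z : SignVec n) {e} → Eliminant e X W Z → SepSet Z W ⊂ SepSet X W
    eliminantˡ-⊂ X W Z {e} elim@(e∈S , Ze , _) =
      tabulate-does-⊂ (InSep? Z W) (InSep? X W) (eliminantˡ-¬InSep X W Z elim) {e} e∈S
        (λ (Ze≢0 , _) → Ze≢0 Ze)

    eliminantʳ-⊂ : ∀ (X W Z : SignVec n) {e} → Eliminant e X W Z → SepSet X Z ⊂ SepSet X W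
    eliminantʳ-⊂ X W Z {e} elim@(e∈S , Ze , _) =
      tabulate-does-⊂ (InSep? X Z) (InSep? X W) (eliminantʳ-¬InSep X W Z elim) {e} e∈S
        (λ (_ , Ze≢0 , _) → Ze≢0 Ze)

    eliminantˡ-agrees : ∀ (X W Z P : SignVec n) {e} → Eliminant e X W Z →
                        AgreesOff P Z W (Z ∘ᵛ W) → AgreesOff P X W (X ∘ᵛ W)
    eliminantˡ-agrees X W Z P elim@(_ , _ , Z≈) P≈ f f∉S =
      begin
        P at f                         ≡⟨ P≈ f (eliminantˡ-¬InSep X W Z elim f∉S) ⟩
        (Z ∘ᵛ W) at f                  ≡⟨ at-∘ᵛ Z W f ⟩
        Z at f ∘ˢ W at f               ≡⟨ cong (_∘ˢ W at f) (trans (Z≈ f f∉S) (at-∘ᵛ X W f)) ⟩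
        (X at f ∘ˢ W at f) ∘ˢ W at f   ≡⟨ ∘ˢ-absorbʳ (X at f) (W at f) ⟩
        X at f ∘ˢ W at f               ≡⟨ sym (at-∘ᵛ X W f) ⟩
        (X ∘ᵛ W) at f                  ∎

    eliminantʳ-agrees : ∀ (X W Z P : SignVec n) {e} → Eliminant e X W Z →
                        AgreesOff P X Z (X ∘ᵛ Z) → AgreesOff P X W (X ∘ᵛ W)
    eliminantʳ-agrees X W Z P elim@(_ , _ , Z≈) P≈ f f∉S =
      begin
        P at f                         ≡⟨ P≈ f (eliminantʳ-¬InSep X W Z elim f∉S) ⟩
        (X ∘ᵛ Z) at f                  ≡⟨ at-∘ᵛ X Z f ⟩
        X at f ∘ˢ Z at f               ≡⟨ cong (X at f ∘ˢ_) (trans (Z≈ f f∉S) (at-∘ᵛ X W f)) ⟩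
        X at f ∘ˢ (X at f ∘ˢ W at f)   ≡⟨ ∘ˢ-absorbˡ (X at f) (W at f) ⟩
        X at f ∘ˢ W at f               ≡⟨ sym (at-∘ᵛ X W f) ⟩
        (X ∘ᵛ W) at f                  ∎

    negV-eliminant : ∀ (X Y Z : SignVec n) {e} → InSep (negV X) Y e → InIe L e (negV X) Y Z →
                     Eliminant e X (negV Y) (negV Z)
    negV-eliminant X Y Z {e} e∈S (_ , Ze , Z≈) =
      Equivalence.to (InSep-negV⇔ X Y e) e∈S , trans (at-negV Z e) (cong -ˢ_ Ze) , negZ≈
      where
      negZ≈ : AgreesOff (negV Z) X (negV Y) (X ∘ᵛ negV Y)
      negZ≈ f f∉S =
        begin
          negV Z at f                        ≡⟨ at-negV Z f ⟩
          -ˢ (Z at f)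
            ≡⟨ cong -ˢ_ (trans (Z≈ f (f∉S ∘ Equivalence.to (InSep-negV⇔ X Y f))) (at-∘ᵛ (negV X) Y f)) ⟩
          -ˢ (negV X at f ∘ˢ Y at f)
            ≡⟨ -ˢ-∘ˢ (negV X at f) (Y at f) ⟩
          -ˢ (negV X at f) ∘ˢ -ˢ (Y at f)
            ≡⟨ cong₂ _∘ˢ_ (trans (cong -ˢ_ (at-negV X f)) (-ˢ-involutive _)) (sym (at-negV Y f)) ⟩
          X at f ∘ˢ negV Y at f
            ≡⟨ sym (at-∘ᵛ X (negV Y) f) ⟩
          (X ∘ᵛ negV Y) at f                 ∎

    -- Replacing X (or Y) by an element of I(X,-Y) (or I(-X,Y)) shrinks S(X,-Y) while keeping
    -- X ∘ -Y outside it; once both sets are empty, X ⊕ -Y is the required element of 𝒫.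
    𝒫-approximation : ∀ {X Y} → X ∈ L → Y ∈ L →
                      ∃[ P ] InP L P × AgreesOff P X (negV Y) (X ∘ᵛ negV Y)
    𝒫-approximation = go (⊂-wellFounded _)
      where
      go : ∀ {X Y} → Acc _⊂_ (SepSet X (negV Y)) → X ∈ L → Y ∈ L →
           ∃[ P ] InP L P × AgreesOff P X (negV Y) (X ∘ᵛ negV Y)
      go {X} {Y} (acc smaller) X∈L Y∈L with I? X (negV Y) | I? (negV X) Y
      ... | yes (e , e∈S , Z , Z∈L , Z∈I) | _ =
        let P , P∈𝒫 , P≈ = go (smaller (eliminantˡ-⊂ X (negV Y) Z elim)) Z∈L Y∈L
        in P , P∈𝒫 , eliminantˡ-agrees X (negV Y) Z P elim P≈
        where
        elim : Eliminant e X (negV Y) Z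
        elim = e∈S , Z∈I
      ... | no _ | yes (e , e∈S , Z , Z∈L , Z∈I) =
        let P , P∈𝒫 , P≈ = go (smaller (eliminantʳ-⊂ X (negV Y) (negV Z) elim)) X∈L Z∈L
        in P , P∈𝒫 , eliminantʳ-agrees X (negV Y) (negV Z) P elim P≈
        where
        elim : Eliminant e X (negV Y) (negV Z)
        elim = negV-eliminant X Y Z e∈S (Z∈L , Z∈I)
      ... | no I₁ | no I₂ = X ⊕ᵛ negV Y , (X , Y , X∈L , Y∈L , I₁ , I₂ , refl) , λ f f∉S →
        trans (at-⊕ᵛ X (negV Y) f) (trans (⊕ˢ-¬Sep _ _ f∉S) (sym (at-∘ᵛ X (negV Y) f)))

    𝒫-agrees-on-zeros : ∀ {X Y} → X ∈ L → Y ∈ L →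
                        ∃[ P ] InP L P × (∀ f → Y at f ≡ zer → P at f ≡ X at f)
    𝒫-agrees-on-zeros {X} {Y} X∈L Y∈L =
      let P , P∈𝒫 , P≈ = 𝒫-approximation X∈L Y∈L
      in P , P∈𝒫 , λ f Yf →
        let -Yf≡0 = trans (at-negV Y f) (cong -ˢ_ Yf)
        in trans (P≈ f (λ (_ , -Yf≢0 , _) → -Yf≢0 -Yf≡0)) (∘ᵛ-zeroʳ-at {X} {negV Y} -Yf≡0)

  module _ {L : SignSet n} (aom : IsAOM L) where
    open IsAOM aom using (SE) renaming (P to 𝒫∘-closed)

    ∥-zeros-agree : ∀ {f g X Y} → Parallel L f g → X ∈ L → X at f ≡ zer → Y ∈ L → Y at f ≡ zer →
                    X at g ≡ Y at g
    ∥-zeros-agree {f} {g} {X} {Y} f∥g X∈L Xf Y∈L Yf with X at g ≟ˢ Y at g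
    ... | yes Xg≡Yg = Xg≡Yg
    ... | no Xg≢Yg =
      let Z , Z∈L , Zg , Z≈ = SE X Y X∈L Y∈L g (∥⇒nonzero f∥g X∈L Xf , ∥⇒nonzero f∥g Y∈L Yf , Xg≢Yg)
          Zf = trans (Z≈ f λ (Xf≢0 , _) → Xf≢0 Xf) (trans (at-∘ᵛ X Y f) (cong₂ _∘ˢ_ Xf Yf))
      in ⊥-elim (f∥g (Z , Z∈L , Zf , Zg))

    -- If W at g ≠ X at g, then W itself (when W at g = 0) or the elimination of g between W and X
    -- vanishes at g and agrees with W at f, since X at f = 0.
    ∥-dichotomy : ∀ {f g X Y W} → Parallel L f g → X ∈ L → X at f ≡ zer → Y ∈ L → Y at g ≡ zer →
                  W ∈ L → W at f ≡ Y at f ⊎ W at g ≡ X at g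
    ∥-dichotomy {f} {g} {X} {Y} {W} f∥g X∈L Xf Y∈L Yg W∈L with W at g ≟ˢ X at g | W at g ≟ˢ zer
    ... | yes Wg≡Xg | _ = inj₂ Wg≡Xg
    ... | no _ | yes Wg = inj₁ (∥-zeros-agree (∥-sym f∥g) W∈L Wg Y∈L Yg)
    ... | no Wg≢Xg | no Wg≢0 =
      let Z , Z∈L , Zg , Z≈ = SE W X W∈L X∈L g (Wg≢0 , ∥⇒nonzero f∥g X∈L Xf , Wg≢Xg)
          Zf = trans (Z≈ f λ (_ , Xf≢0 , _) → Xf≢0 Xf) (∘ᵛ-zeroʳ-at {W} {X} Xf)
      in inj₁ (trans (sym Zf) (∥-zeros-agree (∥-sym f∥g) Z∈L Zg Y∈L Yg))

    𝒫-compatible : ∀ {f g X Y P} → Parallel L f g → X ∈ L → X at f ≡ zer → Y ∈ L → Y at g ≡ zer →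
                   InP L P → Compatible (X at g) (Y at f) (P at f) (P at g)
    𝒫-compatible {f} {g} {X} {Y} {P} f∥g X∈L Xf Y∈L Yg P∈𝒫 =
      Sum.map (trans (sym (∘ᵛ-zeroʳ-at {P} {X} Xf))) (trans (sym (at-∘ᵛ P X g)))
        (dichotomy (𝒫∘-closed P X P∈𝒫 X∈L)) ,
      Sum.map (trans (sym (at-∘ᵛ P Y f))) (trans (sym (∘ᵛ-zeroʳ-at {P} {Y} Yg)))
        (dichotomy (𝒫∘-closed P Y P∈𝒫 Y∈L))
      where
      dichotomy : ∀ {W} → W ∈ L → W at f ≡ Y at f ⊎ W at g ≡ X at g
      dichotomy = ∥-dichotomy f∥g X∈L Xf Y∈L Yg

    𝒫-cross : ∀ {f g X Y P} → Parallel L f g → X ∈ L → X at f ≡ zer → Y ∈ L → Y at g ≡ zer →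
              InP L P → X at g *ˢ P at g ≡ -ˢ (Y at f *ˢ P at f)
    𝒫-cross {f} {g} {X} {Y} {P} f∥g X∈L Xf Y∈L Yg P∈𝒫 =
      Compatible±⇒cross _ _ _ _ (∥⇒nonzero f∥g X∈L Xf) (∥⇒nonzero (∥-sym f∥g) Y∈L Yg)
        (compatible P∈𝒫)
        (subst₂ (Compatible _ _) (at-negV P f) (at-negV P g) (compatible (𝒫-neg L P∈𝒫)))
      where
      compatible : ∀ {V} → InP L V → Compatible (X at g) (Y at f) (V at f) (V at g)
      compatible = 𝒫-compatible f∥g X∈L Xf Y∈L Yg

    Btw-intro : ∀ {f g h X Z} → Parallel L f g → Parallel L h g → f ≢ g → g ≢ h → f ≢ h →
                X ∈ L → X at f ≡ zer → Z ∈ L → Z at h ≡ zer → X at g ≡ -ˢ (Z at g) → Btw L f g h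
    Btw-intro {g = g} {X = X} {Z} f∥g h∥g f≢g g≢h f≢h X∈L Xf Z∈L Zh Xg≡-Zg =
      f≢g , g≢h , f≢h , λ X′ Z′ X′∈L Z′∈L X′f Z′h →
        begin
          X′ at g       ≡⟨ ∥-zeros-agree f∥g X′∈L X′f X∈L Xf ⟩
          X at g        ≡⟨ Xg≡-Zg ⟩
          -ˢ (Z at g)   ≡⟨ cong -ˢ_ (∥-zeros-agree h∥g Z∈L Zh Z′∈L Z′h) ⟩
          -ˢ (Z′ at g)  ∎

    module _ (simple : IsSimple L) where
      open IsSimple simple

      zero-exists : ∀ e → ∃[ X ] X ∈ L × X at e ≡ zer
      zero-exists e with ∃∈? (λ X → X at e ≟ˢ zer) L
      ... | yes has-zero = has-zero
      ... | no no-zero = ⊥-elim (noConst e constant)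
        where
        constant : ∀ X Y → X ∈ L → Y ∈ L → X at e ≡ Y at e
        constant X Y X∈L Y∈L with X at e ≟ˢ Y at e
        ... | yes Xe≡Ye = Xe≡Ye
        ... | no Xe≢Ye =
          let nonzero : ∀ {V} → V ∈ L → V at e ≢ zer
              nonzero V∈L Ve = no-zero (_ , V∈L , Ve)
              Z , Z∈L , Ze , _ = SE X Y X∈L Y∈L e (nonzero X∈L , nonzero Y∈L , Xe≢Ye)
          in ⊥-elim (nonzero Z∈L Ze)

      -- Given X vanishing at a and b and Y vanishing at e, transporting each W ∈ L into 𝒫 along the
      -- zeros of X and applying the cross relation with X, Y gives Y a · W a = Y b · W b for all
      -- W ∈ L: a and b would be equal or opposite elements.
      ∥-trans : ∀ {e a b} → Parallel L e a → Parallel L e b → a ≢ b → Parallel L a b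
      ∥-trans {e} {a} {b} e∥a e∥b a≢b (X , X∈L , Xa , Xb) with zero-exists e
      ... | Y , Y∈L , Ye =
        [ (λ cancel → noEqual a b a≢b λ W W∈L → cancel (scaled W∈L))
        , (λ cancel → noOpp a b a≢b λ W W∈L → cancel (scaled W∈L)) ]′
        (*ˢ-cancel (∥⇒nonzero e∥a Y∈L Ye) (∥⇒nonzero e∥b Y∈L Ye))
        where
        scaled : ∀ {W} → W ∈ L → Y at a *ˢ W at a ≡ Y at b *ˢ W at b
        scaled {W} W∈L =
          let P , P∈𝒫 , P≈W = 𝒫-agrees-on-zeros L W∈L X∈L
          in begin
            Y at a *ˢ W at a   ≡⟨ cong (Y at a *ˢ_) (sym (P≈W a Xa)) ⟩
            Y at a *ˢ P at a   ≡⟨ -ˢ-injective (trans (sym (𝒫-cross (∥-sym e∥a) X∈L Xa Y∈L Ye P∈𝒫))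
                                                      (𝒫-cross (∥-sym e∥b) X∈L Xb Y∈L Ye P∈𝒫)) ⟩
            Y at b *ˢ P at b   ≡⟨ cong (Y at b *ˢ_) (P≈W b Xb) ⟩
            Y at b *ˢ W at b   ∎

      ∥-in-class : ∀ {π a b} → IsParClass L π → π a → π b → a ≢ b → Parallel L a b
      ∥-in-class {a = a} {b} (e , π⇔) πa πb a≢b
        with Equivalence.to (π⇔ a) πa | Equivalence.to (π⇔ b) πb
      ... | inj₁ refl | inj₁ refl = ⊥-elim (a≢b refl)
      ... | inj₁ refl | inj₂ e∥b = e∥b
      ... | inj₂ e∥a | inj₁ refl = ∥-sym e∥a
      ... | inj₂ e∥a | inj₂ e∥b = ∥-trans e∥a e∥b a≢b

      Btw-asym : ∀ {a b c} → Parallel L a c → Parallel L c b → Btw L a b c → ¬ Btw L a c b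
      Btw-asym {a} {b} {c} a∥c c∥b (_ , _ , _ , abc) (_ , _ , _ , acb)
        with zero-exists a | zero-exists b | zero-exists c
      ... | A , A∈L , Aa | B , B∈L , Bb | C , C∈L , Cc =
        ∥⇒nonzero a∥c A∈L Aa
          (self-opposite⇒zer (trans (acb A B A∈L B∈L Aa Bb) (cong -ˢ_ (sym Ac≡Bc))))
        where
        Ac≡Bc : A at c ≡ B at c
        Ac≡Bc = [ id , (λ Ab≡Cb → ⊥-elim (∥⇒nonzero c∥b C∈L Cc
                          (self-opposite⇒zer (trans (sym Ab≡Cb) (abc A C A∈L C∈L Aa Cc))))) ]′
                  (∥-dichotomy c∥b C∈L Cc B∈L Bb A∈L)

      Btw-extend : ∀ {a b c x} → Parallel L a b → Parallel L c b → Parallel L x b → Btw L a b c →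
                   x ≢ a → x ≢ b → x ≢ c → Btw L a b x ⊎ Btw L x b c
      Btw-extend {a} {b} {c} {x} a∥b c∥b x∥b (a≢b , b≢c , _ , abc) x≢a x≢b x≢c
        with zero-exists a | zero-exists c | zero-exists x
      ... | A , A∈L , Aa | C , C∈L , Cc | X , X∈L , Xx
        with equal-or-opposite (∥⇒nonzero x∥b X∈L Xx) (∥⇒nonzero a∥b A∈L Aa)
      ... | inj₂ Xb≡-Ab =
        inj₁ (Btw-intro a∥b x∥b a≢b (≢-sym x≢b) (≢-sym x≢a) A∈L Aa X∈L Xx (opposite-sym Xb≡-Ab))
      ... | inj₁ Xb≡Ab =
        inj₂ (Btw-intro x∥b c∥b x≢b b≢c x≢c X∈L Xx C∈L Cc (trans Xb≡Ab (abc A C A∈L C∈L Aa Cc)))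

      -- With P ∈ 𝒫 agreeing with B at a, the cross relations for the pairs ab, ac and bc force
      -- u = A at b · P at b to satisfy u = -1 and u = -u.
      zeros-disagree : ∀ {a b c A B C} → Parallel L a b → Parallel L a c → Parallel L b c →
                       A ∈ L → A at a ≡ zer → B ∈ L → B at b ≡ zer → C ∈ L → C at c ≡ zer →
                       B at a ≡ C at a → A at b ≡ C at b → A at c ≡ B at c → ⊥
      zeros-disagree {a} {b} {c} {A} {B} {C} a∥b a∥c b∥c A∈L Aa B∈L Bb C∈L Cc Ba≡Ca Ab≡Cb Ac≡Bc
        with 𝒫-agrees-on-zeros L B∈L A∈L
      ... | P , P∈𝒫 , P≈B = neg≢zer (trans (sym u≡neg) (self-opposite⇒zer (trans (sym v≡u) v≡-u)))
        where
        neg≢zer : neg ≢ zer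
        neg≢zer ()
        u≡neg : A at b *ˢ P at b ≡ neg
        u≡neg = begin
          A at b *ˢ P at b        ≡⟨ 𝒫-cross a∥b A∈L Aa B∈L Bb P∈𝒫 ⟩
          -ˢ (B at a *ˢ P at a)   ≡⟨ cong (λ s → -ˢ (B at a *ˢ s)) (P≈B a Aa) ⟩
          -ˢ (B at a *ˢ B at a)   ≡⟨ cong -ˢ_ (*ˢ-self (∥⇒nonzero (∥-sym a∥b) B∈L Bb)) ⟩
          neg                     ∎
        v≡u : A at c *ˢ P at c ≡ A at b *ˢ P at b
        v≡u = begin
          A at c *ˢ P at c        ≡⟨ 𝒫-cross a∥c A∈L Aa C∈L Cc P∈𝒫 ⟩
          -ˢ (C at a *ˢ P at a)   ≡⟨ cong (λ s → -ˢ (s *ˢ P at a)) (sym Ba≡Ca) ⟩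
          -ˢ (B at a *ˢ P at a)   ≡⟨ sym (𝒫-cross a∥b A∈L Aa B∈L Bb P∈𝒫) ⟩
          A at b *ˢ P at b        ∎
        v≡-u : A at c *ˢ P at c ≡ -ˢ (A at b *ˢ P at b)
        v≡-u = begin
          A at c *ˢ P at c        ≡⟨ cong (_*ˢ P at c) Ac≡Bc ⟩
          B at c *ˢ P at c        ≡⟨ 𝒫-cross b∥c B∈L Bb C∈L Cc P∈𝒫 ⟩
          -ˢ (C at b *ˢ P at b)   ≡⟨ cong (λ s → -ˢ (s *ˢ P at b)) (sym Ab≡Cb) ⟩
          -ˢ (A at b *ˢ P at b)   ∎

      Btw-total : ∀ {a b c} → Parallel L a b → Parallel L a c → Parallel L b c →
                  a ≢ b → b ≢ c → a ≢ c →
                  Btw L a b c ⊎ Btw L a c b ⊎ Btw L b a c ⊎ Btw L b c a ⊎ Btw L c a b ⊎ Btw L c b a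
      Btw-total {a} {b} {c} a∥b a∥c b∥c a≢b b≢c a≢c
        with zero-exists a | zero-exists b | zero-exists c
      ... | A , A∈L , Aa | B , B∈L , Bb | C , C∈L , Cc
        with equal-or-opposite (∥⇒nonzero a∥b A∈L Aa) (∥⇒nonzero (∥-sym b∥c) C∈L Cc)
           | equal-or-opposite (∥⇒nonzero (∥-sym a∥b) B∈L Bb) (∥⇒nonzero (∥-sym a∥c) C∈L Cc)
           | equal-or-opposite (∥⇒nonzero a∥c A∈L Aa) (∥⇒nonzero b∥c B∈L Bb)
      ... | inj₂ Ab≡-Cb | _ | _ =
        inj₁ (Btw-intro a∥b (∥-sym b∥c) a≢b b≢c a≢c A∈L Aa C∈L Cc Ab≡-Cb)
      ... | inj₁ _ | inj₂ Ba≡-Ca | _ =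
        inj₂ (inj₂ (inj₁
          (Btw-intro (∥-sym a∥b) (∥-sym a∥c) (≢-sym a≢b) a≢c b≢c B∈L Bb C∈L Cc Ba≡-Ca)))
      ... | inj₁ _ | inj₁ _ | inj₂ Ac≡-Bc =
        inj₂ (inj₁ (Btw-intro a∥c b∥c a≢c (≢-sym b≢c) a≢b A∈L Aa B∈L Bb Ac≡-Bc))
      ... | inj₁ Ab≡Cb | inj₁ Ba≡Ca | inj₁ Ac≡Bc =
        ⊥-elim (zeros-disagree a∥b a∥c b∥c A∈L Aa B∈L Bb C∈L Cc Ba≡Ca Ab≡Cb Ac≡Bc)

  reorientV-zero⇔ : ∀ τ (X : SignVec n) e → reorientV τ X at e ≡ zer ⇔ X at e ≡ zer
  reorientV-zero⇔ τ X e rewrite lookup-zipWith (actˢ {n}) e τ X with lookup τ e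
  ... | true = mk⇔ id id
  ... | false = mk⇔ -ˢ-injective (cong -ˢ_)

  reorientV-opposite⇔ : ∀ τ (X Z : SignVec n) e →
                        reorientV τ X at e ≡ -ˢ (reorientV τ Z at e) ⇔ X at e ≡ -ˢ (Z at e)
  reorientV-opposite⇔ τ X Z e
    rewrite lookup-zipWith (actˢ {n}) e τ X | lookup-zipWith (actˢ {n}) e τ Z with lookup τ e
  ... | true = mk⇔ id id
  ... | false = mk⇔ -ˢ-injective (cong -ˢ_)

  Btw-reorient : ∀ τ {L : SignSet n} {f g h} → Btw (reorient τ L) f g h ⇔ Btw L f g h
  Btw-reorient τ {L} {f} {g} {h} = mk⇔ to from
    where
    to : Btw (reorient τ L) f g h → Btw L f g h
    to (f≢g , g≢h , f≢h , fgh) = f≢g , g≢h , f≢h , λ X Z X∈L Z∈L Xf Zh →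
      Equivalence.to (reorientV-opposite⇔ τ X Z g)
        (fgh (reorientV τ X) (reorientV τ Z) (∈-map⁺ (reorientV τ) X∈L) (∈-map⁺ (reorientV τ) Z∈L)
             (Equivalence.from (reorientV-zero⇔ τ X f) Xf) (Equivalence.from (reorientV-zero⇔ τ Z h) Zh))
    from : Btw L f g h → Btw (reorient τ L) f g h
    from (f≢g , g≢h , f≢h , fgh) = f≢g , g≢h , f≢h , reoriented
      where
      reoriented : ∀ X′ Z′ → X′ ∈ reorient τ L → Z′ ∈ reorient τ L →
                   X′ at f ≡ zer → Z′ at h ≡ zer → X′ at g ≡ -ˢ (Z′ at g)
      reoriented X′ Z′ X′∈ Z′∈ with ∈-map⁻ (reorientV τ) X′∈ | ∈-map⁻ (reorientV τ) Z′∈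
      ... | X , X∈L , refl | Z , Z∈L , refl = λ X′f Z′h →
        Equivalence.from (reorientV-opposite⇔ τ X Z g)
          (fgh X Z X∈L Z∈L (Equivalence.to (reorientV-zero⇔ τ X f) X′f)
                           (Equivalence.to (reorientV-zero⇔ τ Z h) Z′h))

proposition2p26 : ∀ (n : ℕ) (L : SignSet n) → IsAOM L → IsSimple L →
    (π : Fin n → Set) → IsParClass L π →
    (∀ (a b c x : Fin n) → π a → π b → π c → π x →
        -- BR1
        (Btw L a b c → (a ≢ b) × (b ≢ c) × (a ≢ c))
        -- BR2
      × ((a ≢ b) → (b ≢ c) → (a ≢ c) →
           Btw L a b c ⊎ Btw L a c b ⊎ Btw L b a c ⊎
           Btw L b c a ⊎ Btw L c a b ⊎ Btw L c b a)
        -- BR3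
      × (Btw L a b c → Btw L c b a)
        -- BR4
      × ¬ (Btw L a b c × Btw L a c b)
        -- BR5
      × (Btw L a b c → x ≢ a → x ≢ b → x ≢ c → Btw L a b x ⊎ Btw L x b c))
  × (∀ (τ : Vec Bool n) (f g h : Fin n) → π f → π g → π h →
        Btw (reorient τ L) f g h ⇔ Btw L f g h)
proposition2p26 n L aom simple π class =
  (λ a b c x πa πb πc πx →
      (λ (a≢b , b≢c , a≢c , _) → a≢b , b≢c , a≢c)
    , (λ a≢b b≢c a≢c →
         Btw-total aom simple (∥ πa πb a≢b) (∥ πa πc a≢c) (∥ πb πc b≢c) a≢b b≢c a≢c)
    , Btw-sym
    , (λ (abc@(_ , b≢c , a≢c , _) , acb) →
         Btw-asym aom simple (∥ πa πc a≢c) (∥ πc πb (≢-sym b≢c)) abc acb)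
    , (λ abc@(a≢b , b≢c , _) x≢a x≢b x≢c →
         Btw-extend aom simple (∥ πa πb a≢b) (∥ πc πb (≢-sym b≢c)) (∥ πx πb x≢b)
           abc x≢a x≢b x≢c))
  , λ τ _ _ _ _ _ _ → Btw-reorient τ
  where
  ∥ : ∀ {u v} → π u → π v → u ≢ v → Parallel L u v
  ∥ = ∥-in-class aom simple class
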